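{- Let $t>s\ge 0$ be integers and let $n$ be a positive integer. Suppose $\mathcal{F}\subset\{0,1\}^n$ is a collection of binary vectors such that for every two distinct $\vec{x},\vec{y}\in\mathcal{F}$, the Hamming distance $d(\vec{x},\vec{y})$ lies in $\{2s+1,2s+2,\dots,2t\}$. Then $$|\mathcal{F}|\le\binom{n}{t-s}+2\sum_{i=0}^{t-s-1}\binom{n}{i}.$$
   Context: The Hamming distance $d(\vec{x},\vec{y})$ between two vectors is the number of coordinates in which they differ. -}

module Defs where

open import Data.Nat using (ℕ; zero; suc; _+_)
open import Data.Bool using (Bool)
open import Data.Vec using (Vec; []; _∷_)
open import Data.Nat.Combinatorics using (_C_)
open import Relation.Nullary using (does)
open import Data.Bool.Properties using () renaming (_≟_ to _≟ᵇ_)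

hamming : ∀ {n} → Vec Bool n → Vec Bool n → ℕ
hamming [] [] = 0
hamming (a ∷ xs) (b ∷ ys) with does (a ≟ᵇ b)
... | Bool.true  = hamming xs ys
... | Bool.false = suc (hamming xs ys)

sumBinom : ℕ → ℕ → ℕ
sumBinom n zero = 0
sumBinom n (suc k) = sumBinom n k + n C k

-- Let k = t − s and, for x ∈ F, g_x(z) = G(d(x, z)) on the cube, where G(d) is
-- 2 ∏_{j=1}^{k} (d − 2(s+j)) for even d and 2 ∏_{j=1}^{k} (d − 2(s+j) + 1) for odd d.
-- G vanishes on {2s+1, …, 2t} but not at 0, so the matrix (g_x(y))_{x,y ∈ F} is diagonal
-- and nonsingular, and the g_x are linearly independent.  Writing G(d) as
-- (E + O) + (−1)^d (E − O) with E, O the two products, and (−1)^{d(x,z)} = (−1)^{|x|} (−1)^{|z|},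
-- each g_x is a multilinear polynomial of degree ≤ k plus (−1)^{|z|} times one of degree ≤ k − 1
-- (E and O are both monic, so E − O loses a degree).  These functions span a space of dimension
-- Σ_{i≤k} C(n,i) + Σ_{i<k} C(n,i) = C(n,k) + 2 Σ_{i<k} C(n,i).

module Submission where

open import Defs
open import Data.Nat as ℕ using (ℕ; zero; suc; z≤n; s≤s; _∸_)
open import Data.Nat.Properties as ℕP
  using (≤-trans; ≤-refl; ≤-reflexive; +-mono-≤; +-monoʳ-≤; n≤1+n; m≤n⇒m≤1+n)
import Data.Nat.Tactic.RingSolver as ℕ-Solver
open import Data.Nat.Combinatorics using (_C_; nCk+nC[k+1]≡[n+1]C[k+1])
open import Data.Integer as ℤ using (ℤ; 0ℤ; 1ℤ; -1ℤ; _+_; _*_; _-_; -_; +_)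
import Data.Integer.Properties as ℤP
open import Data.Integer.Tactic.RingSolver using (solve-∀)
open import Algebra.Properties.Semiring.Sum ℤP.+-*-semiring
  using (sum; ∑-distrib-+; *-distribˡ-sum; sum-cong-≗; sum-replicate-zero)
open import Data.Bool using (Bool; true; false)
open import Data.Vec as Vec using (Vec; []; _∷_)
open import Data.Vec.Functional using (Vector; _++_; tail)
open import Data.Fin using (Fin; zero; suc; punchIn; splitAt)
open import Data.Fin.Properties using (any?; punchIn-injective; punchInᵢ≢i)
open import Data.Fin.Subset using (Subset; inside; outside; ⊥; ⁅_⁆; _∪_; ∣_∣)
open import Data.Fin.Subset.Properties using (∣⊥∣≡0; ∣⁅x⁆∣≡1)
open import Data.List as List using (List; []; _∷_; map; length; lookup)
open import Data.List.Properties using (length-map; length-++)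
open import Data.List.Relation.Unary.All as All using ()
open import Data.List.Relation.Unary.AllPairs using (_∷_)
open import Data.List.Relation.Unary.Any using (here; index)
open import Data.List.Relation.Unary.Any.Properties using (lookup-index)
open import Data.List.Relation.Unary.Unique.Propositional using (Unique)
open import Data.List.Membership.Propositional using (_∈_)
open import Data.List.Membership.Propositional.Properties using (∈-map⁺; ∈-++⁺ˡ; ∈-++⁺ʳ; ∈-lookup)
open import Data.Product using (Σ-syntax; ∃-syntax; _,_; _×_; proj₁; proj₂; uncurry)
open import Data.Sum using (_⊎_; inj₁; inj₂)
open import Data.Sum.Properties using ([,]-map; [,]-∘)
open import Data.Empty using (⊥-elim)
open import Relation.Nullary using (¬?; yes; no)
open import Relation.Binary.PropositionalEquality
open import Function using (_∘_)

infix 7 _·_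
_·_ : ∀ {N} → Vector ℤ N → Vector ℤ N → ℤ
u · v = sum (λ l → u l * v l)

·-comm : ∀ {N} (u v : Vector ℤ N) → u · v ≡ v · u
·-comm u v = sum-cong-≗ (λ l → ℤP.*-comm (u l) (v l))

·-distribʳ-+ : ∀ {N} (u v w : Vector ℤ N) → u · (λ l → v l + w l) ≡ u · v + u · w
·-distribʳ-+ u v w =
  trans (sum-cong-≗ (λ l → ℤP.*-distribˡ-+ (u l) (v l) (w l))) (∑-distrib-+ (λ l → u l * v l) (λ l → u l * w l))

·-scaleʳ : ∀ {N} a (u v : Vector ℤ N) → u · (λ l → a * v l) ≡ a * (u · v)
·-scaleʳ a u v = trans (sum-cong-≗ (λ l → swap (u l) a (v l))) (sym (*-distribˡ-sum a (λ l → u l * v l)))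
  where
  swap : ∀ x a y → x * (a * y) ≡ a * (x * y)
  swap = solve-∀

·-distribˡ-+ : ∀ {N} (u v w : Vector ℤ N) → (λ l → u l + v l) · w ≡ u · w + v · w
·-distribˡ-+ u v w = trans (·-comm _ w) (trans (·-distribʳ-+ w u v) (cong₂ _+_ (·-comm w u) (·-comm w v)))

·-scaleˡ : ∀ {N} a (u v : Vector ℤ N) → (λ l → a * u l) · v ≡ a * (u · v)
·-scaleˡ a u v = trans (·-comm _ v) (trans (·-scaleʳ a v u) (cong (a *_) (·-comm v u)))

·-zeroˡ : ∀ {N} (v : Vector ℤ N) → (λ _ → 0ℤ) · v ≡ 0ℤ
·-zeroˡ {N} v = trans (sum-cong-≗ (λ l → ℤP.*-zeroˡ (v l))) (sum-replicate-zero N)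

basis : ∀ {N} → Fin N → Vector ℤ N
basis zero zero = 1ℤ
basis zero (suc _) = 0ℤ
basis (suc i) zero = 0ℤ
basis (suc i) (suc l) = basis i l

·-basisˡ : ∀ {N} (i : Fin N) (v : Vector ℤ N) → basis i · v ≡ v i
·-basisˡ zero v =
  trans (cong (λ r → 1ℤ * v zero + r) (·-zeroˡ (tail v))) (trans (ℤP.+-identityʳ _) (ℤP.*-identityˡ _))
·-basisˡ (suc i) v = trans (cong (λ r → 0ℤ * v zero + r) (·-basisˡ i (tail v))) (ℤP.+-identityˡ _)

tail-++ : ∀ {A : Set} {m n} (a : Vector A (suc m)) (b : Vector A n) (l : Fin (m ℕ.+ n)) →
  (a ++ b) (suc l) ≡ (tail a ++ b) l
tail-++ {m = m} a b l = [,]-map (splitAt m l)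

·-++ : ∀ {m n} (a c : Vector ℤ m) (b d : Vector ℤ n) → (a ++ b) · (c ++ d) ≡ a · c + b · d
·-++ {zero} a c b d = sym (ℤP.+-identityˡ _)
·-++ {suc m} a c b d = begin
    a zero * c zero + tail (a ++ b) · tail (c ++ d)
  ≡⟨ cong (λ r → a zero * c zero + r) (sum-cong-≗ λ l → cong₂ _*_ (tail-++ a b l) (tail-++ c d l)) ⟩
    a zero * c zero + (tail a ++ b) · (tail c ++ d)
  ≡⟨ cong (λ r → a zero * c zero + r) (·-++ (tail a) (tail c) b d) ⟩
    a zero * c zero + (tail a · tail c + b · d)
  ≡⟨ sym (ℤP.+-assoc (a zero * c zero) (tail a · tail c) (b · d)) ⟩
    a · c + b · d
  ∎
  where open ≡-Reasoning

*-≢0 : ∀ {a b : ℤ} → a ≢ 0ℤ → b ≢ 0ℤ → a * b ≢ 0ℤ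
*-≢0 {a} a≢0 b≢0 ab≡0 with ℤP.i*j≡0⇒i≡0∨j≡0 a ab≡0
... | inj₁ a≡0 = a≢0 a≡0
... | inj₂ b≡0 = b≢0 b≡0

·-head-zeroʳ : ∀ {N} (u v : Vector ℤ (suc N)) → v zero ≡ 0ℤ → u · v ≡ tail u · tail v
·-head-zeroʳ u v v₀≡0 = begin
    u zero * v zero + tail u · tail v
  ≡⟨ cong (λ x → u zero * x + tail u · tail v) v₀≡0 ⟩
    u zero * 0ℤ + tail u · tail v
  ≡⟨ cong (_+ tail u · tail v) (ℤP.*-zeroʳ (u zero)) ⟩
    0ℤ + tail u · tail v
  ≡⟨ ℤP.+-identityˡ _ ⟩
    tail u · tail v
  ∎
  where open ≡-Reasoning

biorthogonal⇒≤ : ∀ {N m} (u v : Fin m → Vector ℤ N) →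
  (∀ {i j} → i ≢ j → u i · v j ≡ 0ℤ) → (∀ i → u i · v i ≢ 0ℤ) → m ℕ.≤ N
biorthogonal⇒≤ {zero} {zero} u v off diag = z≤n
biorthogonal⇒≤ {zero} {suc m} u v off diag = ⊥-elim (diag zero refl)
biorthogonal⇒≤ {suc N} u v off diag with any? (λ j → ¬? (v j zero ℤ.≟ 0ℤ))
... | no ∄pivot = m≤n⇒m≤1+n (biorthogonal⇒≤ (tail ∘ u) (tail ∘ v)
        (λ {i} {j} i≢j → trans (sym (drop i j)) (off i≢j))
        (λ i → diag i ∘ trans (drop i i)))
  where
  column≡0 : ∀ j → v j zero ≡ 0ℤ
  column≡0 j with v j zero ℤ.≟ 0ℤ
  ... | yes vj₀≡0 = vj₀≡0
  ... | no vj₀≢0 = ⊥-elim (∄pivot (j , vj₀≢0))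
  drop : ∀ i j → u i · v j ≡ tail (u i) · tail (v j)
  drop i j = ·-head-zeroʳ (u i) (v j) (column≡0 j)
-- Pivot on vₚ: subtracting multiples of vₚ clears the first coordinate of the other vⱼ,
-- and since ⟨uᵢ, vₚ⟩ = 0 for i ≠ p this only scales their pairings with the uᵢ by a.
biorthogonal⇒≤ {suc N} {suc m} u v off diag | yes (p , a≢0) =
  s≤s (biorthogonal⇒≤ u′ v′
        (λ {i} {j} i≢j → trans (reduce i j) (off′ i≢j))
        (λ i → *-≢0 a≢0 (diag (skip i)) ∘ trans (sym (reduce i i))))
  where
  a : ℤ
  a = v p zero
  skip : Fin m → Fin (suc m)
  skip = punchIn p
  w : Fin m → Vector ℤ (suc N)
  w j l = a * v (skip j) l + (- v (skip j) zero) * v p l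
  w₀≡0 : ∀ j → w j zero ≡ 0ℤ
  w₀≡0 j = cancel a (v (skip j) zero)
    where
    cancel : ∀ x y → x * y + (- y) * x ≡ 0ℤ
    cancel = solve-∀
  u′ v′ : Fin m → Vector ℤ N
  u′ i = tail (u (skip i))
  v′ j = tail (w j)
  reduce : ∀ i j → u′ i · v′ j ≡ a * (u (skip i) · v (skip j))
  reduce i j = begin
      u′ i · v′ j
    ≡⟨ sym (·-head-zeroʳ (u (skip i)) (w j) (w₀≡0 j)) ⟩
      u (skip i) · w j
    ≡⟨ ·-distribʳ-+ (u (skip i)) (λ l → a * v (skip j) l) (λ l → (- v (skip j) zero) * v p l) ⟩
      u (skip i) · (λ l → a * v (skip j) l) + u (skip i) · (λ l → (- v (skip j) zero) * v p l)
    ≡⟨ cong₂ _+_ (·-scaleʳ a (u (skip i)) (v (skip j))) (·-scaleʳ (- v (skip j) zero) (u (skip i)) (v p)) ⟩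
      a * (u (skip i) · v (skip j)) + (- v (skip j) zero) * (u (skip i) · v p)
    ≡⟨ cong (λ x → a * (u (skip i) · v (skip j)) + (- v (skip j) zero) * x) (off (punchInᵢ≢i p i)) ⟩
      a * (u (skip i) · v (skip j)) + (- v (skip j) zero) * 0ℤ
    ≡⟨ cong (λ r → a * (u (skip i) · v (skip j)) + r) (ℤP.*-zeroʳ (- v (skip j) zero)) ⟩
      a * (u (skip i) · v (skip j)) + 0ℤ
    ≡⟨ ℤP.+-identityʳ _ ⟩
      a * (u (skip i) · v (skip j))
    ∎
    where open ≡-Reasoning
  off′ : ∀ {i j} → i ≢ j → a * (u (skip i) · v (skip j)) ≡ 0ℤ
  off′ {i} {j} i≢j = trans (cong (a *_) (off (i≢j ∘ punchIn-injective p i j))) (ℤP.*-zeroʳ a)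

Spanned : ∀ {X : Set} {N} → Vector (X → ℤ) N → (X → ℤ) → Set
Spanned {X} {N} e f = Σ[ c ∈ Vector ℤ N ] (∀ x → f x ≡ c · (λ l → e l x))

diagonal-criterion : ∀ {X : Set} {N m} (e : Vector (X → ℤ) N) (f : Fin m → X → ℤ) (p : Fin m → X) →
  (∀ i → Spanned e (f i)) → (∀ {i j} → i ≢ j → f i (p j) ≡ 0ℤ) → (∀ i → f i (p i) ≢ 0ℤ) → m ℕ.≤ N
diagonal-criterion e f p spanned off diag =
  biorthogonal⇒≤ (proj₁ ∘ spanned) (λ j l → e l (p j))
    (λ {i} {j} i≢j → trans (sym (proj₂ (spanned i) (p j))) (off i≢j))
    (λ i → diag i ∘ trans (proj₂ (spanned i) (p i)))

Spanned-++ : ∀ {X : Set} {N N′} {e : Vector (X → ℤ) N} {e′ : Vector (X → ℤ) N′} {f g : X → ℤ} →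
  Spanned e f → Spanned e′ g → Spanned (e ++ e′) (λ x → f x + g x)
Spanned-++ {N = N} {e = e} {e′} {f} {g} (c , f≡) (c′ , g≡) = c ++ c′ , λ x → begin
    f x + g x
  ≡⟨ cong₂ _+_ (f≡ x) (g≡ x) ⟩
    c · (λ l → e l x) + c′ · (λ l → e′ l x)
  ≡⟨ sym (·-++ c (λ l → e l x) c′ (λ l → e′ l x)) ⟩
    (c ++ c′) · ((λ l → e l x) ++ (λ l → e′ l x))
  ≡⟨ sum-cong-≗ (λ l → cong ((c ++ c′) l *_) (sym ([,]-∘ (λ φ → φ x) {e} {e′} (splitAt N l)))) ⟩
    (c ++ c′) · (λ l → (e ++ e′) l x)
  ∎
  where open ≡-Reasoning

Spanned-*ˡ : ∀ {X : Set} {N} {e : Vector (X → ℤ) N} {f : X → ℤ} (h : X → ℤ) →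
  Spanned e f → Spanned (λ l x → h x * e l x) (λ x → h x * f x)
Spanned-*ˡ {e = e} h (c , f≡) =
  c , λ x → trans (cong (h x *_) (f≡ x)) (sym (·-scaleʳ (h x) c (λ l → e l x)))

Spanned-≗ : ∀ {X : Set} {N} {e : Vector (X → ℤ) N} {f g : X → ℤ} →
  (∀ x → f x ≡ g x) → Spanned e f → Spanned e g
Spanned-≗ f≗g (c , f≡) = c , λ x → trans (sym (f≗g x)) (f≡ x)

bit : Bool → ℤ
bit true = 1ℤ
bit false = 0ℤ

monomial : ∀ {n} → Subset n → Vec Bool n → ℤ
monomial [] [] = 1ℤ
monomial (outside ∷ S) (_ ∷ z) = monomial S z
monomial (inside ∷ S) (b ∷ z) = bit b * monomial S z

bit-idem : ∀ b → bit b * bit b ≡ bit b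
bit-idem true = refl
bit-idem false = refl

monomial-∪ : ∀ {n} (S T : Subset n) z → monomial S z * monomial T z ≡ monomial (S ∪ T) z
monomial-∪ [] [] [] = refl
monomial-∪ (outside ∷ S) (outside ∷ T) (b ∷ z) = monomial-∪ S T z
monomial-∪ (outside ∷ S) (inside ∷ T) (b ∷ z) =
  trans (swap (monomial S z) (bit b) (monomial T z)) (cong (bit b *_) (monomial-∪ S T z))
  where
  swap : ∀ x y w → x * (y * w) ≡ y * (x * w)
  swap = solve-∀
monomial-∪ (inside ∷ S) (outside ∷ T) (b ∷ z) =
  trans (ℤP.*-assoc (bit b) (monomial S z) (monomial T z)) (cong (bit b *_) (monomial-∪ S T z))
monomial-∪ (inside ∷ S) (inside ∷ T) (b ∷ z) =
  trans (regroup (bit b) (monomial S z) (monomial T z)) (cong₂ _*_ (bit-idem b) (monomial-∪ S T z))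
  where
  regroup : ∀ x y w → (x * y) * (x * w) ≡ (x * x) * (y * w)
  regroup = solve-∀

monomial-⊥ : ∀ {n} (z : Vec Bool n) → monomial ⊥ z ≡ 1ℤ
monomial-⊥ [] = refl
monomial-⊥ (_ ∷ z) = monomial-⊥ z

∣p∪q∣≤∣p∣+∣q∣ : ∀ {n} (S T : Subset n) → ∣ S ∪ T ∣ ℕ.≤ ∣ S ∣ ℕ.+ ∣ T ∣
∣p∪q∣≤∣p∣+∣q∣ [] [] = z≤n
∣p∪q∣≤∣p∣+∣q∣ (outside ∷ S) (outside ∷ T) = ∣p∪q∣≤∣p∣+∣q∣ S T
∣p∪q∣≤∣p∣+∣q∣ (outside ∷ S) (inside ∷ T) = ≤-trans (s≤s (∣p∪q∣≤∣p∣+∣q∣ S T)) (≤-reflexive (sym (ℕP.+-suc ∣ S ∣ ∣ T ∣)))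
∣p∪q∣≤∣p∣+∣q∣ (inside ∷ S) (outside ∷ T) = s≤s (∣p∪q∣≤∣p∣+∣q∣ S T)
∣p∪q∣≤∣p∣+∣q∣ (inside ∷ S) (inside ∷ T) = s≤s (≤-trans (∣p∪q∣≤∣p∣+∣q∣ S T) (+-monoʳ-≤ ∣ S ∣ (n≤1+n ∣ T ∣)))

data Deg≤ {n : ℕ} (k : ℕ) : (Vec Bool n → ℤ) → Set where
  mon : (S : Subset n) → ∣ S ∣ ℕ.≤ k → Deg≤ k (monomial S)
  zero-fn : Deg≤ k (λ _ → 0ℤ)
  add : ∀ {f g} → Deg≤ k f → Deg≤ k g → Deg≤ k (λ z → f z + g z)
  scale : ∀ {f} (c : ℤ) → Deg≤ k f → Deg≤ k (λ z → c * f z)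
  pointwise : ∀ {f g} → (∀ z → f z ≡ g z) → Deg≤ k f → Deg≤ k g

Deg≤-monomial-* : ∀ {n j k} (S : Subset n) → ∣ S ∣ ℕ.≤ j → {g : Vec Bool n → ℤ} →
  Deg≤ k g → Deg≤ (j ℕ.+ k) (λ z → monomial S z * g z)
Deg≤-monomial-* S ∣S∣≤j (mon T ∣T∣≤k) =
  pointwise (λ z → sym (monomial-∪ S T z)) (mon (S ∪ T) (≤-trans (∣p∪q∣≤∣p∣+∣q∣ S T) (+-mono-≤ ∣S∣≤j ∣T∣≤k)))
Deg≤-monomial-* S ∣S∣≤j zero-fn = pointwise (λ z → sym (ℤP.*-zeroʳ (monomial S z))) zero-fn
Deg≤-monomial-* S ∣S∣≤j (add {f} {g} df dg) =
  pointwise (λ z → sym (ℤP.*-distribˡ-+ (monomial S z) (f z) (g z)))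
    (add (Deg≤-monomial-* S ∣S∣≤j df) (Deg≤-monomial-* S ∣S∣≤j dg))
Deg≤-monomial-* S ∣S∣≤j (scale {f} c df) =
  pointwise (λ z → swap (monomial S z) c (f z)) (scale c (Deg≤-monomial-* S ∣S∣≤j df))
  where
  swap : ∀ x c y → c * (x * y) ≡ x * (c * y)
  swap = solve-∀
Deg≤-monomial-* S ∣S∣≤j (pointwise f≗g df) =
  pointwise (λ z → cong (monomial S z *_) (f≗g z)) (Deg≤-monomial-* S ∣S∣≤j df)

Deg≤-* : ∀ {n j k} {f g : Vec Bool n → ℤ} → Deg≤ j f → Deg≤ k g → Deg≤ (j ℕ.+ k) (λ z → f z * g z)
Deg≤-* (mon S ∣S∣≤j) dg = Deg≤-monomial-* S ∣S∣≤j dg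
Deg≤-* {g = g} zero-fn dg = pointwise (λ z → sym (ℤP.*-zeroˡ (g z))) zero-fn
Deg≤-* {g = g} (add {f₁} {f₂} df₁ df₂) dg =
  pointwise (λ z → sym (ℤP.*-distribʳ-+ (g z) (f₁ z) (f₂ z))) (add (Deg≤-* df₁ dg) (Deg≤-* df₂ dg))
Deg≤-* {g = g} (scale {f} c df) dg = pointwise (λ z → sym (ℤP.*-assoc c (f z) (g z))) (scale c (Deg≤-* df dg))
Deg≤-* {g = g} (pointwise f≗f′ df) dg = pointwise (λ z → cong (_* g z) (f≗f′ z)) (Deg≤-* df dg)

Deg≤-const : ∀ {n k} (c : ℤ) → Deg≤ {n} k (λ _ → c)
Deg≤-const {n} c = pointwise (λ z → trans (cong (c *_) (monomial-⊥ z)) (ℤP.*-identityʳ c))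
                             (scale c (mon ⊥ (≤-trans (≤-reflexive (∣⊥∣≡0 n)) z≤n)))

Deg≤-tail : ∀ {n k} {f : Vec Bool n → ℤ} → Deg≤ k f → Deg≤ {suc n} k (λ z → f (Vec.tail z))
Deg≤-tail (mon S ∣S∣≤k) = pointwise (λ { (_ ∷ z) → refl }) (mon (outside ∷ S) ∣S∣≤k)
Deg≤-tail zero-fn = zero-fn
Deg≤-tail (add df dg) = add (Deg≤-tail df) (Deg≤-tail dg)
Deg≤-tail (scale c df) = scale c (Deg≤-tail df)
Deg≤-tail (pointwise f≗g df) = pointwise (λ z → f≗g (Vec.tail z)) (Deg≤-tail df)

Deg≤-head : ∀ {n} → Deg≤ {suc n} 1 (λ z → bit (Vec.head z))
Deg≤-head {n} =
  pointwise (λ { (b ∷ z) → trans (cong (bit b *_) (monomial-⊥ z)) (ℤP.*-identityʳ (bit b)) })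
            (mon ⁅ zero ⁆ (≤-reflexive (∣⁅x⁆∣≡1 {suc n} zero)))

mismatch : Bool → Bool → ℤ
mismatch true b = 1ℤ - bit b
mismatch false b = bit b

hamming-∷ : ∀ {n} a b (x y : Vec Bool n) → + hamming (a ∷ x) (b ∷ y) ≡ mismatch a b + + hamming x y
hamming-∷ true true x y = refl
hamming-∷ true false x y = refl
hamming-∷ false true x y = refl
hamming-∷ false false x y = refl

Deg≤-mismatch : ∀ {n} a → Deg≤ {suc n} 1 (λ z → mismatch a (Vec.head z))
Deg≤-mismatch true =
  pointwise (λ z → complement (bit (Vec.head z))) (add (Deg≤-const 1ℤ) (scale -1ℤ Deg≤-head))
  where
  complement : ∀ x → 1ℤ + -1ℤ * x ≡ 1ℤ - x
  complement = solve-∀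
Deg≤-mismatch false = Deg≤-head

Deg≤-hamming : ∀ {n} (x : Vec Bool n) → Deg≤ 1 (λ z → + hamming x z)
Deg≤-hamming [] = pointwise (λ { [] → refl }) zero-fn
Deg≤-hamming (a ∷ x) =
  pointwise (λ { (b ∷ z) → sym (hamming-∷ a b x z) }) (add (Deg≤-mismatch a) (Deg≤-tail (Deg≤-hamming x)))

subsetsOfSize : ∀ n → ℕ → List (Subset n)
subsetsOfSize zero zero = [] ∷ []
subsetsOfSize zero (suc i) = []
subsetsOfSize (suc n) zero = map (outside ∷_) (subsetsOfSize n zero)
subsetsOfSize (suc n) (suc i) =
  map (inside ∷_) (subsetsOfSize n i) List.++ map (outside ∷_) (subsetsOfSize n (suc i))

length-subsetsOfSize : ∀ n i → length (subsetsOfSize n i) ≡ n C i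
length-subsetsOfSize zero zero = refl
length-subsetsOfSize zero (suc i) = refl
length-subsetsOfSize (suc n) zero =
  trans (length-map (outside ∷_) (subsetsOfSize n zero)) (length-subsetsOfSize n zero)
length-subsetsOfSize (suc n) (suc i) = begin
    length (map (inside ∷_) (subsetsOfSize n i) List.++ map (outside ∷_) (subsetsOfSize n (suc i)))
  ≡⟨ length-++ (map (inside ∷_) (subsetsOfSize n i)) ⟩
    length (map (inside ∷_) (subsetsOfSize n i)) ℕ.+ length (map (outside ∷_) (subsetsOfSize n (suc i)))
  ≡⟨ cong₂ ℕ._+_ (length-map (inside ∷_) (subsetsOfSize n i)) (length-map (outside ∷_) (subsetsOfSize n (suc i))) ⟩
    length (subsetsOfSize n i) ℕ.+ length (subsetsOfSize n (suc i))
  ≡⟨ cong₂ ℕ._+_ (length-subsetsOfSize n i) (length-subsetsOfSize n (suc i)) ⟩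
    n C i ℕ.+ n C suc i
  ≡⟨ nCk+nC[k+1]≡[n+1]C[k+1] n i ⟩
    suc n C suc i
  ∎
  where open ≡-Reasoning

∈-subsetsOfSize : ∀ {n} (S : Subset n) → S ∈ subsetsOfSize n ∣ S ∣
∈-subsetsOfSize [] = here refl
∈-subsetsOfSize (inside ∷ S) = ∈-++⁺ˡ (∈-map⁺ (inside ∷_) (∈-subsetsOfSize S))
∈-subsetsOfSize {suc n} (outside ∷ S) = prepend-outside ∣ S ∣ (∈-subsetsOfSize S)
  where
  prepend-outside : ∀ i → S ∈ subsetsOfSize n i → (outside ∷ S) ∈ subsetsOfSize (suc n) i
  prepend-outside zero S∈ = ∈-map⁺ (outside ∷_) S∈
  prepend-outside (suc i) S∈ = ∈-++⁺ʳ (map (inside ∷_) (subsetsOfSize n i)) (∈-map⁺ (outside ∷_) S∈)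

subsetsBelow : ∀ n → ℕ → List (Subset n)
subsetsBelow n zero = []
subsetsBelow n (suc k) = subsetsBelow n k List.++ subsetsOfSize n k

length-subsetsBelow : ∀ n k → length (subsetsBelow n k) ≡ sumBinom n k
length-subsetsBelow n zero = refl
length-subsetsBelow n (suc k) =
  trans (length-++ (subsetsBelow n k)) (cong₂ ℕ._+_ (length-subsetsBelow n k) (length-subsetsOfSize n k))

∈-subsetsBelow : ∀ {n} k (S : Subset n) → ∣ S ∣ ℕ.< k → S ∈ subsetsBelow n k
∈-subsetsBelow (suc k) S (s≤s ∣S∣≤k) with ∣ S ∣ ℕ.≟ k
... | yes refl = ∈-++⁺ʳ (subsetsBelow _ k) (∈-subsetsOfSize S)
... | no ∣S∣≢k = ∈-++⁺ˡ (∈-subsetsBelow k S (ℕP.≤∧≢⇒< ∣S∣≤k ∣S∣≢k))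

monomialsBelow : ∀ n k → Vector (Vec Bool n → ℤ) (length (subsetsBelow n k))
monomialsBelow n k l = monomial (lookup (subsetsBelow n k) l)

Deg≤⇒Spanned : ∀ {n k} {f : Vec Bool n → ℤ} → Deg≤ k f → Spanned (monomialsBelow n (suc k)) f
Deg≤⇒Spanned {n} {k} (mon S ∣S∣≤k) = basis (index S∈) , λ z → begin
    monomial S z
  ≡⟨ cong (λ T → monomial T z) (lookup-index S∈) ⟩
    monomialsBelow n (suc k) (index S∈) z
  ≡⟨ sym (·-basisˡ (index S∈) (λ l → monomialsBelow n (suc k) l z)) ⟩
    basis (index S∈) · (λ l → monomialsBelow n (suc k) l z)
  ∎
  where
  open ≡-Reasoning
  S∈ = ∈-subsetsBelow (suc k) S (s≤s ∣S∣≤k)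
Deg≤⇒Spanned {n} {k} zero-fn = (λ _ → 0ℤ) , λ z → sym (·-zeroˡ (λ l → monomialsBelow n (suc k) l z))
Deg≤⇒Spanned {n} {k} (add df dg) with Deg≤⇒Spanned df | Deg≤⇒Spanned dg
... | c , f≡ | c′ , g≡ = (λ l → c l + c′ l) , λ z →
  trans (cong₂ _+_ (f≡ z) (g≡ z)) (sym (·-distribˡ-+ c c′ (λ l → monomialsBelow n (suc k) l z)))
Deg≤⇒Spanned {n} {k} (scale a df) with Deg≤⇒Spanned df
... | c , f≡ = (λ l → a * c l) , λ z →
  trans (cong (a *_) (f≡ z)) (sym (·-scaleˡ a c (λ l → monomialsBelow n (suc k) l z)))
Deg≤⇒Spanned (pointwise f≗g df) with Deg≤⇒Spanned df
... | c , f≡ = c , λ z → trans (sym (f≗g z)) (f≡ z)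

rootProduct : (ℕ → ℤ) → ℕ → ℤ → ℤ
rootProduct r zero d = 1ℤ
rootProduct r (suc k) d = (d - r (suc k)) * rootProduct r k d

rootProduct-root : ∀ r k j d → 1 ℕ.≤ j → j ℕ.≤ k → d ≡ r j → rootProduct r k d ≡ 0ℤ
rootProduct-root r zero .zero d () z≤n _
rootProduct-root r (suc k) j d 1≤j j≤1+k d≡rj with j ℕ.≟ suc k
... | yes refl = trans (cong (_* rootProduct r k d) (trans (cong (_- r (suc k)) d≡rj) (ℤP.+-inverseʳ (r (suc k)))))
                       (ℤP.*-zeroˡ (rootProduct r k d))
... | no j≢1+k =
  trans (cong ((d - r (suc k)) *_) (rootProduct-root r k j d 1≤j (ℕP.≤-pred (ℕP.≤∧≢⇒< j≤1+k j≢1+k)) d≡rj))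
        (ℤP.*-zeroʳ (d - r (suc k)))

rootProduct≢0 : ∀ r k d → (∀ j → 1 ℕ.≤ j → j ℕ.≤ k → d ≢ r j) → rootProduct r k d ≢ 0ℤ
rootProduct≢0 r zero d _ ()
rootProduct≢0 r (suc k) d no-root =
  *-≢0 (no-root (suc k) (s≤s z≤n) ≤-refl ∘ ℤP.i-j≡0⇒i≡j d (r (suc k)))
       (rootProduct≢0 r k d (λ j 1≤j j≤k → no-root j 1≤j (m≤n⇒m≤1+n j≤k)))

Deg≤-rootProduct : ∀ {n} {D : Vec Bool n → ℤ} r k → Deg≤ 1 D → Deg≤ k (λ z → rootProduct r k (D z))
Deg≤-rootProduct r zero dD = Deg≤-const 1ℤ
Deg≤-rootProduct r (suc k) dD = Deg≤-* (add dD (Deg≤-const (- r (suc k)))) (Deg≤-rootProduct r k dD)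

Deg≤-rootProduct-difference : ∀ {n} {D : Vec Bool n → ℤ} r₁ r₂ k → Deg≤ 1 D →
  Deg≤ k (λ z → rootProduct r₁ (suc k) (D z) - rootProduct r₂ (suc k) (D z))
Deg≤-rootProduct-difference {D = D} r₁ r₂ zero dD =
  pointwise (λ z → expand (D z) (r₁ 1) (r₂ 1)) (Deg≤-const (r₂ 1 - r₁ 1))
  where
  expand : ∀ d a b → b - a ≡ (d - a) * 1ℤ - (d - b) * 1ℤ
  expand = solve-∀
Deg≤-rootProduct-difference {D = D} r₁ r₂ (suc k) dD =
  pointwise (λ z → expand (D z) (r₁ (2 ℕ.+ k)) (r₂ (2 ℕ.+ k)) (rootProduct r₁ (suc k) (D z)) (rootProduct r₂ (suc k) (D z)))
    (add (Deg≤-* (add dD (Deg≤-const (- r₁ (2 ℕ.+ k)))) (Deg≤-rootProduct-difference r₁ r₂ k dD))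
         (scale (r₂ (2 ℕ.+ k) - r₁ (2 ℕ.+ k)) (Deg≤-rootProduct r₂ (suc k) dD)))
  where
  expand : ∀ d a b P Q → (d + - a) * (P - Q) + (b - a) * Q ≡ (d - a) * P - (d - b) * Q
  expand = solve-∀

sign : ℕ → ℤ
sign zero = 1ℤ
sign (suc d) = - sign d

cubeSign : ∀ {n} → Vec Bool n → ℤ
cubeSign [] = 1ℤ
cubeSign (true ∷ z) = - cubeSign z
cubeSign (false ∷ z) = cubeSign z

cubeSign-* : ∀ {n} (x y : Vec Bool n) → cubeSign x * cubeSign y ≡ sign (hamming x y)
cubeSign-* [] [] = refl
cubeSign-* (true ∷ x) (true ∷ y) = trans (neg*neg (cubeSign x) (cubeSign y)) (cubeSign-* x y)
  where
  neg*neg : ∀ a b → (- a) * (- b) ≡ a * b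
  neg*neg = solve-∀
cubeSign-* (true ∷ x) (false ∷ y) = trans (sym (ℤP.neg-distribˡ-* (cubeSign x) (cubeSign y))) (cong -_ (cubeSign-* x y))
cubeSign-* (false ∷ x) (true ∷ y) = trans (sym (ℤP.neg-distribʳ-* (cubeSign x) (cubeSign y))) (cong -_ (cubeSign-* x y))
cubeSign-* (false ∷ x) (false ∷ y) = cubeSign-* x y

halve : ∀ d → ∃[ m ] ((d ≡ 2 ℕ.* m × sign d ≡ 1ℤ) ⊎ (suc d ≡ 2 ℕ.* m × sign d ≡ -1ℤ))
halve zero = 0 , inj₁ (refl , refl)
halve (suc d) with halve d
... | m , inj₁ (d≡2m , sign≡1) =
  suc m , inj₂ (trans (cong (λ x → suc (suc x)) d≡2m) (sym (ℕP.*-suc 2 m)) , cong -_ sign≡1)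
... | m , inj₂ (1+d≡2m , sign≡-1) = m , inj₁ (1+d≡2m , cong -_ sign≡-1)

evenRoot oddRoot : ℕ → ℤ
evenRoot m = + (2 ℕ.* m)
oddRoot m = + (2 ℕ.* m ∸ 1)

evenProduct oddProduct : ℕ → ℕ → ℤ → ℤ
evenProduct s = rootProduct (λ j → evenRoot (s ℕ.+ j))
oddProduct s = rootProduct (λ j → oddRoot (s ℕ.+ j))

separator : ℕ → ℕ → ℕ → ℤ
separator s k d = (E + O) + sign d * (E - O)
  where
  E O : ℤ
  E = evenProduct s k (+ d)
  O = oddProduct s k (+ d)

separator-even : ∀ s k d → sign d ≡ 1ℤ → separator s k d ≡ evenProduct s k (+ d) + evenProduct s k (+ d)
separator-even s k d sign≡1 rewrite sign≡1 = collapse (evenProduct s k (+ d)) (oddProduct s k (+ d))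
  where
  collapse : ∀ E O → (E + O) + 1ℤ * (E - O) ≡ E + E
  collapse = solve-∀

separator-odd : ∀ s k d → sign d ≡ -1ℤ → separator s k d ≡ oddProduct s k (+ d) + oddProduct s k (+ d)
separator-odd s k d sign≡-1 rewrite sign≡-1 = collapse (evenProduct s k (+ d)) (oddProduct s k (+ d))
  where
  collapse : ∀ E O → (E + O) + -1ℤ * (E - O) ≡ O + O
  collapse = solve-∀

halve-bounds : ∀ {s t d m} → 2 ℕ.* s ℕ.+ 1 ℕ.≤ d → d ℕ.≤ 2 ℕ.* t → d ℕ.≤ 2 ℕ.* m → 2 ℕ.* m ℕ.≤ suc d →
  s ℕ.< m × m ℕ.≤ t
halve-bounds {s} {t} {d} {m} 2s+1≤d d≤2t d≤2m 2m≤1+d =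
  ℕP.*-cancelˡ-< 2 s m (≤-trans (≤-trans (≤-reflexive (ℕP.+-comm 1 (2 ℕ.* s))) 2s+1≤d) d≤2m) ,
  ℕP.≤-pred (ℕP.*-cancelˡ-< 2 m (suc t) (≤-trans (s≤s (≤-trans 2m≤1+d (s≤s d≤2t))) (≤-reflexive (sym (ℕP.*-suc 2 t)))))

rootProduct-shifted-root : ∀ (r : ℕ → ℤ) {s t m} d → s ℕ.< m → m ℕ.≤ t → d ≡ r m →
  rootProduct (λ j → r (s ℕ.+ j)) (t ∸ s) d ≡ 0ℤ
rootProduct-shifted-root r {s} {t} {m} d s<m m≤t d≡rm =
  rootProduct-root (λ j → r (s ℕ.+ j)) (t ∸ s) (m ∸ s) d (ℕP.m<n⇒0<n∸m s<m) (ℕP.∸-monoˡ-≤ s m≤t)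
    (trans d≡rm (cong r (sym (ℕP.m+[n∸m]≡n (ℕP.<⇒≤ s<m)))))

separator-vanishes : ∀ {s t d} → 2 ℕ.* s ℕ.+ 1 ℕ.≤ d → d ℕ.≤ 2 ℕ.* t → separator s (t ∸ s) d ≡ 0ℤ
separator-vanishes {s} {t} {d} lo hi with halve d
... | m , inj₁ (d≡2m , sign≡1) =
  trans (separator-even s (t ∸ s) d sign≡1) (cong (λ E → E + E) E≡0)
  where
  bounds = halve-bounds {s} {t} {d} {m} lo hi (≤-reflexive d≡2m) (≤-trans (≤-reflexive (sym d≡2m)) (n≤1+n d))
  E≡0 = rootProduct-shifted-root evenRoot (+ d) (proj₁ bounds) (proj₂ bounds) (cong +_ d≡2m)
... | m , inj₂ (1+d≡2m , sign≡-1) =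
  trans (separator-odd s (t ∸ s) d sign≡-1) (cong (λ O → O + O) O≡0)
  where
  bounds = halve-bounds {s} {t} {d} {m} lo hi (≤-trans (n≤1+n d) (≤-reflexive 1+d≡2m)) (≤-reflexive (sym 1+d≡2m))
  O≡0 = rootProduct-shifted-root oddRoot (+ d) (proj₁ bounds) (proj₂ bounds) (cong (λ x → + (x ∸ 1)) 1+d≡2m)

separator-at-0≢0 : ∀ s k → separator s k 0 ≢ 0ℤ
separator-at-0≢0 s k =
  double≢0 (rootProduct≢0 (λ j → evenRoot (s ℕ.+ j)) k 0ℤ root≢0) ∘ trans (sym (separator-even s k 0 refl))
  where
  root≢0 : ∀ j → 1 ℕ.≤ j → j ℕ.≤ k → 0ℤ ≢ + (2 ℕ.* (s ℕ.+ j))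
  root≢0 j 1≤j _ 0≡root with ℕP.m+n≡0⇒n≡0 s (ℕP.m+n≡0⇒m≡0 (s ℕ.+ j) (sym (ℤP.+-injective 0≡root)))
  root≢0 .zero () _ 0≡root | refl
  double≢0 : ∀ {x} → x ≢ 0ℤ → x + x ≢ 0ℤ
  double≢0 {x} x≢0 = *-≢0 {+ 2} (λ ()) x≢0 ∘ trans (twice x)
    where
    twice : ∀ x → + 2 * x ≡ x + x
    twice = solve-∀

hamming-self : ∀ {n} (x : Vec Bool n) → hamming x x ≡ 0
hamming-self [] = refl
hamming-self (true ∷ x) = hamming-self x
hamming-self (false ∷ x) = hamming-self x

Unique-lookup : ∀ {A : Set} {xs : List A} → Unique xs → ∀ {i j} → i ≢ j → lookup xs i ≢ lookup xs j
Unique-lookup (x∉ ∷ _) {zero} {zero} i≢j = ⊥-elim (i≢j refl)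
Unique-lookup (x∉ ∷ _) {zero} {suc j} _ = All.lookup x∉ (∈-lookup j)
Unique-lookup (x∉ ∷ _) {suc i} {zero} _ = All.lookup x∉ (∈-lookup i) ∘ sym
Unique-lookup (_ ∷ uniq) {suc i} {suc j} i≢j = Unique-lookup uniq (i≢j ∘ cong suc)

code-bound : ∀ {n} s k (F : List (Vec Bool n)) → Unique F →
  (∀ {x y} → x ∈ F → y ∈ F → x ≢ y → separator s (suc k) (hamming x y) ≡ 0ℤ) →
  length F ℕ.≤ sumBinom n (2 ℕ.+ k) ℕ.+ sumBinom n (suc k)
code-bound {n} s k F uniq vanishes =
  subst (length F ℕ.≤_) (cong₂ ℕ._+_ (length-subsetsBelow n (2 ℕ.+ k)) (length-subsetsBelow n (suc k)))
    (diagonal-criterion family (g ∘ lookup F) (lookup F) (g-spanned ∘ lookup F)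
      (λ {i} {j} i≢j → vanishes (∈-lookup i) (∈-lookup j) (Unique-lookup uniq i≢j))
      (λ i → separator-at-0≢0 s (suc k) ∘ subst (λ d → separator s (suc k) d ≡ 0ℤ) (hamming-self (lookup F i))))
  where
  family : Vector (Vec Bool n → ℤ) (length (subsetsBelow n (2 ℕ.+ k)) ℕ.+ length (subsetsBelow n (suc k)))
  family = monomialsBelow n (2 ℕ.+ k) ++ λ l z → cubeSign z * monomialsBelow n (suc k) l z
  even odd : ℕ → ℤ
  even j = evenRoot (s ℕ.+ j)
  odd j = oddRoot (s ℕ.+ j)
  E O g : Vec Bool n → Vec Bool n → ℤ
  E x z = evenProduct s (suc k) (+ hamming x z)
  O x z = oddProduct s (suc k) (+ hamming x z)
  g x z = separator s (suc k) (hamming x z)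
  g-split : ∀ x z → (E x z + O x z) + cubeSign z * (cubeSign x * (E x z - O x z)) ≡ g x z
  g-split x z = trans (regroup (E x z + O x z) (cubeSign x) (cubeSign z) (E x z - O x z))
                      (cong (λ σ → (E x z + O x z) + σ * (E x z - O x z)) (cubeSign-* x z))
    where
    regroup : ∀ A σ τ B → A + τ * (σ * B) ≡ A + (σ * τ) * B
    regroup = solve-∀
  g-spanned : ∀ x → Spanned family (g x)
  g-spanned x = Spanned-≗ (g-split x) (Spanned-++ (Deg≤⇒Spanned low) (Spanned-*ˡ cubeSign (Deg≤⇒Spanned high)))
    where
    low : Deg≤ (suc k) (λ z → E x z + O x z)
    low = add (Deg≤-rootProduct even (suc k) (Deg≤-hamming x)) (Deg≤-rootProduct odd (suc k) (Deg≤-hamming x))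
    high : Deg≤ k (λ z → cubeSign x * (E x z - O x z))
    high = scale (cubeSign x) (Deg≤-rootProduct-difference even odd k (Deg≤-hamming x))

sumBinom-suc+sumBinom : ∀ n k → sumBinom n (suc k) ℕ.+ sumBinom n k ≡ n C k ℕ.+ 2 ℕ.* sumBinom n k
sumBinom-suc+sumBinom n k = rearrange (sumBinom n k) (n C k)
  where
  rearrange : ∀ S c → (S ℕ.+ c) ℕ.+ S ≡ c ℕ.+ 2 ℕ.* S
  rearrange = ℕ-Solver.solve-∀

theorem4 : (s t n : ℕ) → s ℕ.< t → 1 ℕ.≤ n →
    (F : List (Vec Bool n)) → Unique F →
    (∀ x y → x ∈ F → y ∈ F → x ≢ y →
      (2 ℕ.* s ℕ.+ 1 ℕ.≤ hamming x y) × (hamming x y ℕ.≤ 2 ℕ.* t)) →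
    length F ℕ.≤ n C (t ∸ s) ℕ.+ 2 ℕ.* sumBinom n (t ∸ s)
theorem4 s t n s<t _ F uniq distances
  with t ∸ s | ℕP.m<n⇒0<n∸m s<t | separator-vanishes {s} {t}
... | suc k | _ | vanishes = begin
    length F
  ≤⟨ code-bound s k F uniq (λ x∈F y∈F x≢y → uncurry vanishes (distances _ _ x∈F y∈F x≢y)) ⟩
    sumBinom n (2 ℕ.+ k) ℕ.+ sumBinom n (suc k)
  ≡⟨ sumBinom-suc+sumBinom n (suc k) ⟩
    n C suc k ℕ.+ 2 ℕ.* sumBinom n (suc k)
  ∎
  where open ℕP.≤-Reasoning
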